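{- Let $n \ge 2$ be an integer, $p = \lceil n \lg(n) \rceil$, $z = 2^{ -p}$, and \[R_n(z) = \sum_{k=n+1}^\infty T'_{k,n}\, z^{2k-1} = (2n-1)!\sum_{k=n+1}^\infty T_k\,\frac{z^{2k-1}}{(2k-1)!},\] where $T'_{k,n} = \frac{(2n-1)!}{(2k-1)!}\,T_k$. Then $0 < R_n(z) < 0.1\, z^{2n-1}$.
   Context: Here $\lg$ denotes $\log_2$. The Tangent numbers $T_k$ ($k>0$) are defined by $\sum_{k>0} T_k z^{2k-1}/(2k-1)! = \tan z$. -}

module Defs where

open import Data.Nat as ℕ using (ℕ; zero; suc; _+_; _*_; _∸_; _^_)
open import Data.Nat.Properties using (m*n≢0; m^n≢0; _!≢0)
open import Data.Nat.Combinatorics using (_C_)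
open import Data.Nat.Logarithm using (⌈log₂_⌉)
open import Data.Nat.Base using (_!)
open import Data.List using (List; []; _∷_; _++_; [_])
open import Data.Integer using (+_)
open import Data.Rational as ℚ using (ℚ; _/_)

at : List ℕ → ℕ → ℕ
at []       _       = 0
at (x ∷ xs) zero    = x
at (x ∷ xs) (suc i) = at xs i

sumTo : ℕ → (ℕ → ℕ) → ℕ
sumTo zero    f = f 0
sumTo (suc m) f = sumTo m f + f (suc m)

-- Taylor coefficients a_m of tan z = Σ a_m z^m / m!  (a_m = tan^(m)(0)).
-- Determined by tan 0 = 0 and tan' = 1 + tan², i.e.
--   a_0 = 0,  a_{m+1} = [m = 0] + Σ_{i=0}^{m} C(m,i) a_i a_{m-i}.
delta0 : ℕ → ℕ
delta0 zero    = 1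
delta0 (suc _) = 0

tanNext : ℕ → (ℕ → ℕ) → ℕ
tanNext m a = delta0 m + sumTo m (λ i → (m C i) * a i * a (m ∸ i))

tanTable : ℕ → List ℕ
tanTable zero    = 0 ∷ []
tanTable (suc m) = tanTable m ++ [ tanNext m (at (tanTable m)) ]

tanCoeff : ℕ → ℕ
tanCoeff m = at (tanTable m) m

-- Tangent numbers: T k = a_{2k-1}, so Σ_{k>0} T_k z^{2k-1}/(2k-1)! = tan z.
T : ℕ → ℕ
T k = tanCoeff (2 * k ∸ 1)

-- p = ⌈ n lg n ⌉ = ⌈ lg (n^n) ⌉
prec : ℕ → ℕ
prec n = ⌈log₂ (n ^ n) ⌉

-- term of R_n(z) for z = 2^{-p}:
--   T'_{k,n} z^{2k-1} = (2n-1)! T_k / ((2k-1)! · 2^{p(2k-1)})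
term : ℕ → ℕ → ℚ
term n k = _/_ (+ (((2 * n ∸ 1) !) * T k)) (((2 * k ∸ 1) !) * (2 ^ (prec n * (2 * k ∸ 1))))
  {{m*n≢0 ((2 * k ∸ 1) !) (2 ^ (prec n * (2 * k ∸ 1))) {{(2 * k ∸ 1) !≢0}} {{m^n≢0 2 (prec n * (2 * k ∸ 1))}}}}

partialR : ℕ → ℕ → ℚ
partialR n zero    = ℚ.0ℚ
partialR n (suc N) = partialR n N ℚ.+ term n (n + suc N)

-- 0.1 · z^{2n-1} = 1 / (10 · 2^{p(2n-1)})
bound : ℕ → ℚ
bound n = _/_ (+ 1) (10 * 2 ^ (prec n * (2 * n ∸ 1)))
  {{m*n≢0 10 (2 ^ (prec n * (2 * n ∸ 1))) {{_}} {{m^n≢0 2 (prec n * (2 * n ∸ 1))}}}}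

{-# OPTIONS --safe #-}
module Submission where

-- The Taylor coefficients a_m of tan obey a_{m+1} = Σ_i C(m,i) a_i a_{m-i}; by parity the even ones
-- vanish, and inductively T_k · 2^(k-1) ≤ (2k-1)! with T_k > 0. So the (n+j)-th term of R_n(z) is
-- positive and at most (2n-1)! / (2^(n-1) · 2^(p(2n-1)) · q^j) with q = 2^(2p+1), and all partial sums
-- stay below the geometric sum (2n-1)! / (2^(n-1) · 2^(p(2n-1)) · (q-1)). Pairing i with 2n-i gives
-- (2n-1)! ≤ n^(2n-1), and 2^p ≥ n^n, so this sum is below z^(2n-1)/10 once 2^(n-1) n > 10, i.e.
-- for n ≥ 3; the case n = 2 is a direct computation.

open import Defs

module SumTo where
  open import Data.Nat
  open import Data.Nat.Properties
  open import Data.Sum using (inj₁; inj₂)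
  open import Relation.Binary.PropositionalEquality

  sumTo-cong : ∀ m {f g} → (∀ {i} → i ≤ m → f i ≡ g i) → sumTo m f ≡ sumTo m g
  sumTo-cong zero    f≗g = f≗g z≤n
  sumTo-cong (suc m) f≗g = cong₂ _+_ (sumTo-cong m (λ i≤m → f≗g (m≤n⇒m≤1+n i≤m))) (f≗g ≤-refl)

  sumTo-zero : ∀ m {f} → (∀ {i} → i ≤ m → f i ≡ 0) → sumTo m f ≡ 0
  sumTo-zero zero    f≡0 = f≡0 z≤n
  sumTo-zero (suc m) f≡0 = cong₂ _+_ (sumTo-zero m (λ i≤m → f≡0 (m≤n⇒m≤1+n i≤m))) (f≡0 ≤-refl)

  sumTo-*ʳ : ∀ m f c → sumTo m f * c ≡ sumTo m (λ i → f i * c)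
  sumTo-*ʳ zero    f c = refl
  sumTo-*ʳ (suc m) f c = trans (*-distribʳ-+ c (sumTo m f) (f (suc m))) (cong (_+ f (suc m) * c) (sumTo-*ʳ m f c))

  ≤-sumTo : ∀ m f {i} → i ≤ m → f i ≤ sumTo m f
  ≤-sumTo zero    f z≤n = ≤-refl
  ≤-sumTo (suc m) f i≤1+m with m≤n⇒m<n∨m≡n i≤1+m
  ... | inj₁ (s≤s i≤m) = ≤-trans (≤-sumTo m f i≤m) (m≤m+n (sumTo m f) (f (suc m)))
  ... | inj₂ refl      = m≤n+m (f (suc m)) (sumTo m f)

  sumTo-odd-support-≤ : ∀ k f {B} →
    (∀ u → 2 * u ≤ 2 * k → f (2 * u) ≡ 0) →
    (∀ u → suc (2 * u) ≤ 2 * k → f (suc (2 * u)) ≤ B) →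
    sumTo (2 * k) f ≤ k * B
  sumTo-odd-support-≤ zero    f even _   = ≤-reflexive (even 0 z≤n)
  sumTo-odd-support-≤ (suc k) f {B} even odd = begin
    sumTo (2 * suc k) f                                        ≡⟨ cong (λ l → sumTo l f) (*-suc 2 k) ⟩
    sumTo (2 * k) f + f (suc (2 * k)) + f (suc (suc (2 * k)))  ≡⟨ cong (sumTo (2 * k) f + f (suc (2 * k)) +_) (trans (cong f (sym (*-suc 2 k))) (even (suc k) ≤-refl)) ⟩
    sumTo (2 * k) f + f (suc (2 * k)) + 0                      ≡⟨ +-identityʳ _ ⟩
    sumTo (2 * k) f + f (suc (2 * k))                          ≤⟨ +-mono-≤ previous (odd k (*-monoʳ-< 2 (n<1+n k))) ⟩
    k * B + B                                                  ≡⟨ +-comm (k * B) B ⟩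
    suc k * B                                                  ∎
    where
    open ≤-Reasoning
    widen : ∀ {l} → l ≤ 2 * k → l ≤ 2 * suc k
    widen l≤2k = ≤-trans l≤2k (*-monoʳ-≤ 2 (n≤1+n k))
    previous : sumTo (2 * k) f ≤ k * B
    previous = sumTo-odd-support-≤ k f (λ u le → even u (widen le)) (λ u le → odd u (widen le))

module TangentNumbers where
  open import Data.Nat
  open import Data.Nat.Properties
  open import Data.Nat.Combinatorics using (_C_; nC1≡n; nCk≡n!/k![n-k]!; k![n∸k]!∣n!)
  open import Data.Nat.DivMod using (m/n*n≡m)
  open import Data.Nat.Induction using (<-rec)
  open import Data.Nat.Solver using (module +-*-Solver)
  open import Data.List using ([]; _∷_; _++_; [_]; length)
  open import Data.List.Properties using (length-++)
  open import Data.Sum using (inj₁; inj₂)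
  open import Relation.Binary.PropositionalEquality hiding ([_])
  open +-*-Solver
  open SumTo

  at-++ˡ : ∀ xs {y i} → i < length xs → at (xs ++ [ y ]) i ≡ at xs i
  at-++ˡ (x ∷ xs) {i = zero}  _         = refl
  at-++ˡ (x ∷ xs) {i = suc i} (s≤s i<n) = at-++ˡ xs i<n

  at-++-length : ∀ xs {y} → at (xs ++ [ y ]) (length xs) ≡ y
  at-++-length []       = refl
  at-++-length (x ∷ xs) = at-++-length xs

  length-tanTable : ∀ m → length (tanTable m) ≡ suc m
  length-tanTable zero    = refl
  length-tanTable (suc m) = trans (length-++ (tanTable m)) (trans (+-comm (length (tanTable m)) 1) (cong suc (length-tanTable m)))

  at-tanTable : ∀ m {i} → i ≤ m → at (tanTable m) i ≡ tanCoeff i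
  at-tanTable zero    z≤n  = refl
  at-tanTable (suc m) i≤1+m with m≤n⇒m<n∨m≡n i≤1+m
  ... | inj₁ (s≤s i≤m) = trans (at-++ˡ (tanTable m) (subst (_ <_) (sym (length-tanTable m)) (s≤s i≤m))) (at-tanTable m i≤m)
  ... | inj₂ refl      = refl

  tanTerm : ℕ → ℕ → ℕ
  tanTerm m i = (m C i) * tanCoeff i * tanCoeff (m ∸ i)

  tanCoeff-suc : ∀ m → tanCoeff (suc m) ≡ delta0 m + sumTo m (tanTerm m)
  tanCoeff-suc m = begin
    at (tanTable m ++ [ next ]) (suc m)                ≡⟨ cong (at (tanTable m ++ [ next ])) (sym (length-tanTable m)) ⟩
    at (tanTable m ++ [ next ]) (length (tanTable m))  ≡⟨ at-++-length (tanTable m) ⟩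
    next                                               ≡⟨ cong (delta0 m +_) (sumTo-cong m stable) ⟩
    delta0 m + sumTo m (tanTerm m)                     ∎
    where
    open ≡-Reasoning
    next = tanNext m (at (tanTable m))
    stable : ∀ {i} → i ≤ m → (m C i) * at (tanTable m) i * at (tanTable m) (m ∸ i) ≡ tanTerm m i
    stable {i} i≤m = cong₂ (λ x y → (m C i) * x * y) (at-tanTable m i≤m) (at-tanTable m (m∸n≤m m i))

  tanTerm-zeroˡ : ∀ m {i} → tanCoeff i ≡ 0 → tanTerm m i ≡ 0
  tanTerm-zeroˡ m {i} aᵢ≡0 rewrite aᵢ≡0 = cong (_* tanCoeff (m ∸ i)) (*-zeroʳ (m C i))

  tanTerm-zeroʳ : ∀ m {i} → tanCoeff (m ∸ i) ≡ 0 → tanTerm m i ≡ 0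
  tanTerm-zeroʳ m {i} aₘ₋ᵢ≡0 rewrite aₘ₋ᵢ≡0 = *-zeroʳ ((m C i) * tanCoeff i)

  data EvenOdd : ℕ → Set where
    even : ∀ u → EvenOdd (2 * u)
    odd  : ∀ u → EvenOdd (suc (2 * u))

  evenOdd : ∀ i → EvenOdd i
  evenOdd zero = even 0
  evenOdd (suc i) with evenOdd i
  ... | even u = odd u
  ... | odd u  = subst EvenOdd (*-suc 2 u) (even (suc u))

  2u≤1+2j⇒u<1+j : ∀ {u j} → 2 * u ≤ suc (2 * j) → u < suc j
  2u≤1+2j⇒u<1+j {u} {j} le = *-cancelˡ-< 2 u (suc j) (≤-trans (s≤s le) (≤-reflexive (sym (*-suc 2 j))))

  2*[1+m]∸1≡1+2*m : ∀ m → 2 * suc m ∸ 1 ≡ suc (2 * m)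
  2*[1+m]∸1≡1+2*m m = cong pred (*-suc 2 m)

  2[1+j]∸[1+2w]≡1+2[j∸w] : ∀ {j w} → w ≤ j → 2 * suc j ∸ suc (2 * w) ≡ suc (2 * (j ∸ w))
  2[1+j]∸[1+2w]≡1+2[j∸w] {j} {w} w≤j = begin
    2 * suc j ∸ suc (2 * w)    ≡⟨ cong (_∸ suc (2 * w)) (*-suc 2 j) ⟩
    suc (2 * j) ∸ 2 * w        ≡⟨ +-∸-assoc 1 (*-monoʳ-≤ 2 w≤j) ⟩
    suc (2 * j ∸ 2 * w)        ≡⟨ cong suc (sym (*-distribˡ-∸ 2 j w)) ⟩
    suc (2 * (j ∸ w))          ∎
    where open ≡-Reasoning

  tanCoeff-even : ∀ u → tanCoeff (2 * u) ≡ 0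
  tanCoeff-even = <-rec _ vanish
    where
    vanish : ∀ u → (∀ {w} → w < u → tanCoeff (2 * w) ≡ 0) → tanCoeff (2 * u) ≡ 0
    vanish zero    _  = refl
    vanish (suc j) ih = trans (cong tanCoeff (*-suc 2 j)) (trans (tanCoeff-suc (suc (2 * j))) (sumTo-zero (suc (2 * j)) term≡0))
      where
      term≡0 : ∀ {i} → i ≤ suc (2 * j) → tanTerm (suc (2 * j)) i ≡ 0
      term≡0 {i} i≤ with evenOdd i
      ... | even w = tanTerm-zeroˡ (suc (2 * j)) {2 * w} (ih {w} (2u≤1+2j⇒u<1+j i≤))
      ... | odd w  = tanTerm-zeroʳ (suc (2 * j)) {suc (2 * w)} (trans (cong tanCoeff (sym (*-distribˡ-∸ 2 j w))) (ih (s≤s (m∸n≤m j w))))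

  C*!*!≡! : ∀ {n k} → k ≤ n → (n C k) * (k ! * (n ∸ k) !) ≡ n !
  C*!*!≡! {n} {k} k≤n = begin
    (n C k) * (k ! * (n ∸ k) !)                    ≡⟨ cong (_* (k ! * (n ∸ k) !)) (nCk≡n!/k![n-k]! k≤n) ⟩
    n ! / (k ! * (n ∸ k) !) * (k ! * (n ∸ k) !)    ≡⟨ m/n*n≡m (k![n∸k]!∣n! k≤n) ⟩
    n !                                            ∎
    where
    open ≡-Reasoning
    instance _ = m*n≢0 (k !) ((n ∸ k) !) {{k !≢0}} {{(n ∸ k) !≢0}}

  C*x*y*[c*d]≤! : ∀ {n k x y c d} → k ≤ n → x * c ≤ k ! → y * d ≤ (n ∸ k) ! → (n C k) * x * y * (c * d) ≤ n !
  C*x*y*[c*d]≤! {n} {k} {x} {y} {c} {d} k≤n xc≤ yd≤ = begin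
    (n C k) * x * y * (c * d)        ≡⟨ solve 5 (λ C x y c d → C :* x :* y :* (c :* d) := C :* ((x :* c) :* (y :* d))) refl (n C k) x y c d ⟩
    (n C k) * ((x * c) * (y * d))    ≤⟨ *-monoʳ-≤ (n C k) (*-mono-≤ xc≤ yd≤) ⟩
    (n C k) * (k ! * (n ∸ k) !)      ≡⟨ C*!*!≡! k≤n ⟩
    n !                              ∎
    where open ≤-Reasoning

  tanCoeff-odd*2^≤! : ∀ j → tanCoeff (suc (2 * j)) * 2 ^ j ≤ (suc (2 * j)) !
  tanCoeff-odd*2^≤! = <-rec _ step
    where
    step : ∀ j → (∀ {w} → w < j → tanCoeff (suc (2 * w)) * 2 ^ w ≤ (suc (2 * w)) !) →
            tanCoeff (suc (2 * j)) * 2 ^ j ≤ (suc (2 * j)) !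
    step zero    _  = ≤-refl
    step (suc j) ih = begin
      tanCoeff (suc M) * 2 ^ suc j               ≡⟨ cong (_* 2 ^ suc j) (tanCoeff-suc M) ⟩
      sumTo M (tanTerm M) * (2 * 2 ^ j)          ≡⟨ solve 2 (λ s x → s :* (con 2 :* x) := s :* x :* con 2) refl (sumTo M (tanTerm M)) (2 ^ j) ⟩
      sumTo M (tanTerm M) * 2 ^ j * 2            ≡⟨ cong (_* 2) (sumTo-*ʳ M (tanTerm M) (2 ^ j)) ⟩
      sumTo M (λ i → tanTerm M i * 2 ^ j) * 2    ≤⟨ *-monoˡ-≤ 2 (sumTo-odd-support-≤ (suc j) _ evenTerm≡0 oddTerm≤) ⟩
      suc j * M ! * 2                            ≡⟨ solve 2 (λ k x → k :* x :* con 2 := (con 2 :* k) :* x) refl (suc j) (M !) ⟩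
      M * M !                                    ≤⟨ *-monoˡ-≤ (M !) (n≤1+n M) ⟩
      suc M * M !                                ∎
      where
      open ≤-Reasoning
      M = 2 * suc j
      evenTerm≡0 : ∀ u → 2 * u ≤ M → tanTerm M (2 * u) * 2 ^ j ≡ 0
      evenTerm≡0 u _ = cong (_* 2 ^ j) (tanTerm-zeroˡ M {2 * u} (tanCoeff-even u))
      oddTerm≤ : ∀ u → suc (2 * u) ≤ M → tanTerm M (suc (2 * u)) * 2 ^ j ≤ M !
      oddTerm≤ u le = begin
        tanTerm M (suc (2 * u)) * 2 ^ j               ≡⟨ cong (tanTerm M (suc (2 * u)) *_) 2^j≡2^u*2^v ⟩
        tanTerm M (suc (2 * u)) * (2 ^ u * 2 ^ v)     ≤⟨ C*x*y*[c*d]≤! le (ih (s≤s u≤j)) bound-v ⟩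
        M !                                           ∎
        where
        u≤j = s≤s⁻¹ (*-cancelˡ-< 2 u (suc j) le)
        v = j ∸ u
        2^j≡2^u*2^v : 2 ^ j ≡ 2 ^ u * 2 ^ v
        2^j≡2^u*2^v = trans (cong (2 ^_) (sym (m+[n∸m]≡n u≤j))) (^-distribˡ-+-* 2 u v)
        bound-v : tanCoeff (M ∸ suc (2 * u)) * 2 ^ v ≤ (M ∸ suc (2 * u)) !
        bound-v = subst (λ l → tanCoeff l * 2 ^ v ≤ l !) (sym (2[1+j]∸[1+2w]≡1+2[j∸w] u≤j)) (ih {v} (s≤s (m∸n≤m j u)))

  tanCoeff-odd-pos : ∀ j → 0 < tanCoeff (suc (2 * j))
  tanCoeff-odd-pos zero    = s≤s z≤n
  tanCoeff-odd-pos (suc j) = begin-strict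
    0                      <⟨ *-mono-≤ (*-mono-≤ (≤-trans (s≤s z≤n) (≤-reflexive (sym (nC1≡n M)))) (≤-refl {1})) aₘ₋₁>0 ⟩
    tanTerm M 1            ≤⟨ ≤-sumTo M (tanTerm M) (s≤s z≤n) ⟩
    sumTo M (tanTerm M)    ≡⟨ sym (tanCoeff-suc M) ⟩
    tanCoeff (suc M)       ∎
    where
    open ≤-Reasoning
    M = 2 * suc j
    aₘ₋₁>0 : 0 < tanCoeff (M ∸ 1)
    aₘ₋₁>0 = subst (λ l → 0 < tanCoeff l) (sym (2*[1+m]∸1≡1+2*m j)) (tanCoeff-odd-pos j)

  T[1+i]*2^i≤[2[1+i]∸1]! : ∀ i → T (suc i) * 2 ^ i ≤ (2 * suc i ∸ 1) !
  T[1+i]*2^i≤[2[1+i]∸1]! i = subst (λ l → tanCoeff l * 2 ^ i ≤ l !) (sym (2*[1+m]∸1≡1+2*m i)) (tanCoeff-odd*2^≤! i)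

  T[1+i]>0 : ∀ i → 0 < T (suc i)
  T[1+i]>0 i = subst (λ l → 0 < tanCoeff l) (sym (2*[1+m]∸1≡1+2*m i)) (tanCoeff-odd-pos i)

module Estimates where
  open import Data.Nat
  open import Data.Nat.Properties
  open import Data.Nat.Logarithm using (⌈log₂_⌉)
  open import Data.Nat.Logarithm.Core using (⌈log2⌉)
  open import Data.Nat.Solver using (module +-*-Solver)
  open import Induction.WellFounded using (Acc; acc)
  open import Relation.Binary.PropositionalEquality
  open +-*-Solver

  n≤2^⌈log2⌉n : ∀ n (rec : Acc _<_ n) → n ≤ 2 ^ ⌈log2⌉ n rec
  n≤2^⌈log2⌉n zero          _        = z≤n
  n≤2^⌈log2⌉n (suc zero)    _        = ≤-refl
  n≤2^⌈log2⌉n (suc (suc n)) (acc rs) = begin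
    suc (suc n)                    ≤⟨ s≤s (s≤s n≤h+h) ⟩
    suc (suc (h + h))              ≡⟨ solve 1 (λ h → con 2 :+ (h :+ h) := con 2 :* (con 1 :+ h)) refl h ⟩
    2 * suc h                      ≤⟨ *-monoʳ-≤ 2 (n≤2^⌈log2⌉n (suc h) _) ⟩
    2 * 2 ^ ⌈log2⌉ (suc h) _       ∎
    where
    open ≤-Reasoning
    h = ⌈ n /2⌉
    n≤h+h : n ≤ h + h
    n≤h+h = ≤-trans (≤-reflexive (sym (⌊n/2⌋+⌈n/2⌉≡n n))) (+-monoˡ-≤ h (⌊n/2⌋≤⌈n/2⌉ n))

  n≤2^⌈log₂n⌉ : ∀ n → n ≤ 2 ^ ⌈log₂ n ⌉
  n≤2^⌈log₂n⌉ n = n≤2^⌈log2⌉n n _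

  [1+e+2k]!≤[1+e+k]^[1+2k]*e! : ∀ e k → (suc (e + 2 * k)) ! ≤ suc (e + k) ^ suc (2 * k) * e !
  [1+e+2k]!≤[1+e+k]^[1+2k]*e! e zero rewrite +-identityʳ e = ≤-reflexive (cong (_* e !) (sym (*-identityʳ (suc e))))
  [1+e+2k]!≤[1+e+k]^[1+2k]*e! e (suc k) = begin
    (suc (e + 2 * suc k)) !                 ≡⟨ cong (λ l → (suc l) !) (solve 2 (λ e k → e :+ con 2 :* (con 1 :+ k) := con 1 :+ (con 1 :+ e :+ con 2 :* k)) refl e k) ⟩
    outer * (suc (suc e + 2 * k)) !         ≤⟨ *-monoʳ-≤ outer ([1+e+2k]!≤[1+e+k]^[1+2k]*e! (suc e) k) ⟩
    outer * (c ^ suc (2 * k) * (suc e) !)   ≡⟨ solve 4 (λ a x b f → a :* (x :* (b :* f)) := a :* b :* x :* f) refl outer (c ^ suc (2 * k)) (suc e) (e !) ⟩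
    outer * suc e * c ^ suc (2 * k) * e !   ≤⟨ *-monoˡ-≤ (e !) (*-monoˡ-≤ (c ^ suc (2 * k)) pairing) ⟩
    c * c * c ^ suc (2 * k) * e !           ≡⟨ cong (_* e !) (*-assoc c c (c ^ suc (2 * k))) ⟩
    c ^ suc (suc (suc (2 * k))) * e !       ≡⟨ cong₂ (λ b l → b ^ l * e !) (cong suc (sym (+-suc e k))) (cong suc (sym (*-suc 2 k))) ⟩
    suc (e + suc k) ^ suc (2 * suc k) * e ! ∎
    where
    open ≤-Reasoning
    outer = suc (suc (suc e + 2 * k))
    c = suc (suc e + k)
    pairing : outer * suc e ≤ c * c
    pairing = begin
      outer * suc e                         ≤⟨ m≤m+n _ (suc k * suc k) ⟩
      outer * suc e + suc k * suc k         ≡⟨ solve 2 (λ e k → (con 3 :+ e :+ con 2 :* k) :* (con 1 :+ e) :+ (con 1 :+ k) :* (con 1 :+ k) := (con 2 :+ e :+ k) :* (con 2 :+ e :+ k)) refl e k ⟩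
      c * c                                 ∎

  [1+2k]!≤[1+k]^[1+2k] : ∀ k → (suc (2 * k)) ! ≤ suc k ^ suc (2 * k)
  [1+2k]!≤[1+k]^[1+2k] k = ≤-trans ([1+e+2k]!≤[1+e+k]^[1+2k]*e! 0 k) (≤-reflexive (*-identityʳ _))

  n^n≤2^prec : ∀ n → n ^ n ≤ 2 ^ prec n
  n^n≤2^prec n = n≤2^⌈log₂n⌉ (n ^ n)

  n≤2*n∸1 : ∀ {n} → 1 ≤ n → n ≤ 2 * n ∸ 1
  n≤2*n∸1 {n} 1≤n = begin
    n              ≤⟨ m≤m+n n (n ∸ 1) ⟩
    n + (n ∸ 1)    ≡⟨ +-∸-assoc n 1≤n ⟨
    n + n ∸ 1      ≡⟨ cong (λ l → n + l ∸ 1) (+-identityʳ n) ⟨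
    2 * n ∸ 1      ∎
    where open ≤-Reasoning

  10*[1+2m]!<2^m*[2^[1+2p]∸1] : ∀ m → 1 ≤ m → 10 * (suc (2 * m)) ! < 2 ^ m * (2 ^ suc (2 * prec (suc m)) ∸ 1)
  10*[1+2m]!<2^m*[2^[1+2p]∸1] (suc zero)    _ = ≤ᵇ⇒≤ 61 62 _   -- p = 2 here: 10 · 3! = 60 < 62 = 2 · (2⁵ ∸ 1)
  10*[1+2m]!<2^m*[2^[1+2p]∸1] (suc (suc k)) _ = begin-strict
    10 * (suc (2 * m)) !                ≤⟨ *-monoʳ-≤ 10 ([1+2k]!≤[1+k]^[1+2k] m) ⟩
    10 * n ^ suc (2 * m)                <⟨ *-monoˡ-< (n ^ suc (2 * m)) {{m^n≢0 n (suc (2 * m))}} 10<2^m*n ⟩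
    2 ^ m * n * n ^ suc (2 * m)         ≡⟨ *-assoc (2 ^ m) n _ ⟩
    2 ^ m * n ^ suc (suc (2 * m))       ≡⟨ cong (λ l → 2 ^ m * n ^ l) (solve 1 (λ m → con 2 :+ con 2 :* m := (con 1 :+ m) :+ (con 1 :+ m)) refl m) ⟩
    2 ^ m * n ^ (n + n)                 ≡⟨ cong (2 ^ m *_) (^-distribˡ-+-* n n n) ⟩
    2 ^ m * (n ^ n * n ^ n)             ≤⟨ *-monoʳ-≤ (2 ^ m) (*-mono-≤ (n^n≤2^prec n) (n^n≤2^prec n)) ⟩
    2 ^ m * (2 ^ p * 2 ^ p)             ≤⟨ *-monoʳ-≤ (2 ^ m) (n≤2*n∸1 (*-mono-≤ (m^n>0 2 p) (m^n>0 2 p))) ⟩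
    2 ^ m * (2 * (2 ^ p * 2 ^ p) ∸ 1)   ≡⟨ cong (λ y → 2 ^ m * (2 * y ∸ 1)) (sym 2^[2p]≡2^p*2^p) ⟩
    2 ^ m * (2 ^ suc (2 * p) ∸ 1)       ∎
    where
    open ≤-Reasoning
    m = suc (suc k)
    n = suc m
    p = prec n
    10<2^m*n : 10 < 2 ^ m * n
    10<2^m*n = ≤-trans (n≤1+n 11) (*-mono-≤ (*-monoʳ-≤ 2 (*-monoʳ-≤ 2 (m^n>0 2 k))) (s≤s (s≤s (s≤s z≤n))))
    2^[2p]≡2^p*2^p : 2 ^ (2 * p) ≡ 2 ^ p * 2 ^ p
    2^[2p]≡2^p*2^p = trans (cong (λ l → 2 ^ (p + l)) (+-identityʳ p)) (^-distribˡ-+-* 2 p p)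

module Fractions where
  open import Data.Nat as ℕ using (ℕ; suc; NonZero)
  import Data.Nat.Properties as ℕP
  open import Data.Nat.Solver using (module +-*-Solver)
  open import Data.Integer as ℤ using (+_; +≤+; +<+)
  import Data.Integer.Properties as ℤP
  import Data.Rational as ℚ
  import Data.Rational.Properties as ℚP
  open import Data.Rational.Unnormalised hiding (NonZero)
  open import Data.Rational.Unnormalised.Properties
  open import Relation.Binary.PropositionalEquality using (_≡_; refl; cong; cong₂; sym; trans; subst₂)

  frac : ℕ → (d : ℕ) → .{{NonZero d}} → ℚᵘ
  frac a d = + a / d

  toℚᵘ-frac : ∀ a d .{{_ : NonZero d}} → ℚ.toℚᵘ (+ a ℚ./ d) ≃ frac a d
  toℚᵘ-frac a (suc d) = ℚP.toℚᵘ-fromℚᵘ (mkℚᵘ (+ a) d)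

  frac-≤ : ∀ {a b c d} .{{_ : NonZero b}} .{{_ : NonZero d}} → a ℕ.* d ℕ.≤ c ℕ.* b → frac a b ≤ frac c d
  frac-≤ {a} {suc b} {c} {suc d} ad≤cb = *≤* (subst₂ ℤ._≤_ (ℤP.pos-* a (suc d)) (ℤP.pos-* c (suc b)) (+≤+ ad≤cb))

  frac-< : ∀ {a b c d} .{{_ : NonZero b}} .{{_ : NonZero d}} → a ℕ.* d ℕ.< c ℕ.* b → frac a b < frac c d
  frac-< {a} {suc b} {c} {suc d} ad<cb = *<* (subst₂ ℤ._<_ (ℤP.pos-* a (suc d)) (ℤP.pos-* c (suc b)) (+<+ ad<cb))

  frac-≃ : ∀ {a b c d} .{{_ : NonZero b}} .{{_ : NonZero d}} → a ℕ.* d ≡ c ℕ.* b → frac a b ≃ frac c d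
  frac-≃ {a} {suc b} {c} {suc d} ad≡cb = *≡* (trans (sym (ℤP.pos-* a (suc d))) (trans (cong +_ ad≡cb) (ℤP.pos-* c (suc b))))

  frac-+ : ∀ a b c d .{{_ : NonZero b}} .{{_ : NonZero d}} →
    frac a b + frac c d ≃ frac (a ℕ.* d ℕ.+ c ℕ.* b) (b ℕ.* d) {{ℕP.m*n≢0 b d}}
  frac-+ a (suc b) c (suc d) = *≡* (cong (ℤ._* (+ (suc b ℕ.* suc d)))
    (trans (cong₂ ℤ._+_ (sym (ℤP.pos-* a (suc d))) (sym (ℤP.pos-* c (suc b)))) (sym (ℤP.pos-+ (a ℕ.* suc d) (c ℕ.* suc b)))))

  0≤frac : ∀ a d .{{_ : NonZero d}} → 0ℚᵘ ≤ frac a d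
  0≤frac a (suc d) = frac-≤ {0} {1} (ℕ.z≤n)

  0<frac : ∀ {a} d .{{_ : NonZero d}} → 0 ℕ.< a → 0ℚᵘ < frac a d
  0<frac {a} d 0<a = frac-< {0} {1} (ℕP.≤-trans 0<a (ℕP.≤-reflexive (sym (ℕP.*-identityʳ a))))

  telescope-≤ : (s b t : ℕ → ℚᵘ) → (∀ N → s (suc N) ≤ s N + b N) → (∀ N → b N + t (suc N) ≃ t N) →
    ∀ N → s N + t N ≤ s 0 + t 0
  telescope-≤ s b t step split ℕ.zero  = ≤-refl
  telescope-≤ s b t step split (suc N) = begin
    s (suc N) + t (suc N)      ≤⟨ +-monoˡ-≤ (t (suc N)) (step N) ⟩
    (s N + b N) + t (suc N)    ≃⟨ +-assoc (s N) (b N) (t (suc N)) ⟩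
    s N + (b N + t (suc N))    ≃⟨ +-congʳ (s N) (split N) ⟩
    s N + t N                  ≤⟨ telescope-≤ s b t step split N ⟩
    s 0 + t 0                  ∎
    where open ≤-Reasoning

  module Geometric (X D r : ℕ) .{{D≢0 : NonZero D}} .{{r≢0 : NonZero r}} where
    open +-*-Solver

    instance
      D*r≢0 : NonZero (D ℕ.* r)
      D*r≢0 = ℕP.m*n≢0 D r

    D*[1+r]^≢0 : ∀ N → NonZero (D ℕ.* suc r ℕ.^ N)
    D*[1+r]^≢0 N = ℕP.m*n≢0 D (suc r ℕ.^ N) {{D≢0}} {{ℕP.m^n≢0 (suc r) N}}

    D*r*[1+r]^≢0 : ∀ N → NonZero (D ℕ.* r ℕ.* suc r ℕ.^ N)
    D*r*[1+r]^≢0 N = ℕP.m*n≢0 (D ℕ.* r) (suc r ℕ.^ N) {{D*r≢0}} {{ℕP.m^n≢0 (suc r) N}}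

    geometricTerm : ℕ → ℚᵘ
    geometricTerm N = frac X (D ℕ.* suc r ℕ.^ suc N) {{D*[1+r]^≢0 (suc N)}}

    geometricTail : ℕ → ℚᵘ
    geometricTail N = frac X (D ℕ.* r ℕ.* suc r ℕ.^ N) {{D*r*[1+r]^≢0 N}}

    geometricTail-split : ∀ N → geometricTerm N + geometricTail (suc N) ≃ geometricTail N
    geometricTail-split N = ≃-trans (frac-+ X dₜ X dₜ' {{D*[1+r]^≢0 (suc N)}} {{D*r*[1+r]^≢0 (suc N)}})
      (frac-≃ {{ℕP.m*n≢0 dₜ dₜ' {{D*[1+r]^≢0 (suc N)}} {{D*r*[1+r]^≢0 (suc N)}}}} {{D*r*[1+r]^≢0 N}} (solve 4
        (λ X D r Y → (X :* (D :* r :* ((con 1 :+ r) :* Y)) :+ X :* (D :* ((con 1 :+ r) :* Y))) :* (D :* r :* Y)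
                  := X :* ((D :* ((con 1 :+ r) :* Y)) :* (D :* r :* ((con 1 :+ r) :* Y))))
        refl X D r (suc r ℕ.^ N)))
      where
      dₜ = D ℕ.* suc r ℕ.^ suc N
      dₜ' = D ℕ.* r ℕ.* suc r ℕ.^ suc N

    partialSums-≤-geometric : (s : ℕ → ℚᵘ) → s 0 ≃ 0ℚᵘ →
      (∀ N → s (suc N) ≤ s N + geometricTerm N) → ∀ N → s N ≤ frac X (D ℕ.* r)
    partialSums-≤-geometric s s₀≃0 step N = begin
      s N                      ≃⟨ +-identityʳ (s N) ⟨
      s N + 0ℚᵘ                ≤⟨ +-monoʳ-≤ (s N) (0≤frac X _ {{D*r*[1+r]^≢0 N}}) ⟩
      s N + geometricTail N    ≤⟨ telescope-≤ s geometricTerm geometricTail step geometricTail-split N ⟩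
      s 0 + geometricTail 0    ≃⟨ +-congˡ (geometricTail 0) s₀≃0 ⟩
      0ℚᵘ + geometricTail 0    ≃⟨ +-identityˡ (geometricTail 0) ⟩
      geometricTail 0          ≃⟨ frac-≃ {{D*r*[1+r]^≢0 0}} (cong (X ℕ.*_) (sym (ℕP.*-identityʳ (D ℕ.* r)))) ⟩
      frac X (D ℕ.* r)         ∎
      where open ≤-Reasoning

open import Data.Nat using (ℕ; _≤_)
open import Data.Rational using (ℚ; _<_; 0ℚ)
open import Data.Rational using () renaming (_≤_ to _≤ℚ_)
open import Data.Product using (_×_; ∃)
open import Data.Nat.Base using (suc; s≤s)
open import Data.Product using (_,_)

module RemainderBounds (m : ℕ) (1≤m : 1 ≤ m) where
  open import Data.Nat as ℕ using (suc; NonZero; _+_; _*_; _∸_; _^_; _!)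
  import Data.Nat.Properties as ℕP
  open import Data.Nat.Solver using (module +-*-Solver)
  open import Data.Integer using (+_)
  import Data.Rational as ℚ
  import Data.Rational.Properties as ℚP
  import Data.Rational.Unnormalised as ℚᵘ
  import Data.Rational.Unnormalised.Properties as ℚᵘP
  open import Relation.Binary.PropositionalEquality
  open +-*-Solver
  open TangentNumbers using (2*[1+m]∸1≡1+2*m; T[1+i]*2^i≤[2[1+i]∸1]!; T[1+i]>0)
  open Estimates using (10*[1+2m]!<2^m*[2^[1+2p]∸1])
  open Fractions

  n = suc m
  p = prec n
  X = (2 * n ∸ 1) !
  Q = 2 ^ (p * (2 * n ∸ 1))
  D = 2 ^ m * Q
  q = 2 ^ suc (2 * p)
  r = q ∸ 1

  1+r≡q : suc r ≡ q
  1+r≡q = ℕP.suc-pred q {{ℕP.m^n≢0 2 (suc (2 * p))}}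

  instance
    Q≢0 : NonZero Q
    Q≢0 = ℕP.m^n≢0 2 (p * (2 * n ∸ 1))

    10*Q≢0 : NonZero (10 * Q)
    10*Q≢0 = ℕP.m*n≢0 10 Q

    D≢0 : NonZero D
    D≢0 = ℕP.m*n≢0 (2 ^ m) Q {{ℕP.m^n≢0 2 m}}

    r≢0 : NonZero r
    r≢0 = ℕ.>-nonZero (ℕP.pred-mono-≤ (ℕP.*-monoʳ-≤ 2 (ℕP.m^n>0 2 (2 * p))))

  open Geometric X D r

  denominator-≡ : ∀ j → D * suc r ^ j ≡ 2 ^ (m + j) * 2 ^ (p * (2 * (n + j) ∸ 1))
  denominator-≡ j = begin
    D * suc r ^ j                                            ≡⟨ cong (λ b → D * b ^ j) 1+r≡q ⟩
    2 ^ m * 2 ^ (p * (2 * n ∸ 1)) * q ^ j                    ≡⟨ cong (2 ^ m * 2 ^ (p * (2 * n ∸ 1)) *_) (ℕP.^-*-assoc 2 (suc (2 * p)) j) ⟩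
    2 ^ m * 2 ^ (p * (2 * n ∸ 1)) * 2 ^ (suc (2 * p) * j)    ≡⟨ cong (_* 2 ^ (suc (2 * p) * j)) (ℕP.^-distribˡ-+-* 2 m _) ⟨
    2 ^ (m + p * (2 * n ∸ 1)) * 2 ^ (suc (2 * p) * j)        ≡⟨ ℕP.^-distribˡ-+-* 2 (m + p * (2 * n ∸ 1)) _ ⟨
    2 ^ (m + p * (2 * n ∸ 1) + suc (2 * p) * j)              ≡⟨ cong (2 ^_) exponent-≡ ⟩
    2 ^ (m + j + p * (2 * (n + j) ∸ 1))                      ≡⟨ ℕP.^-distribˡ-+-* 2 (m + j) _ ⟩
    2 ^ (m + j) * 2 ^ (p * (2 * (n + j) ∸ 1))                ∎
    where
    open ≡-Reasoning
    exponent-≡ : m + p * (2 * n ∸ 1) + suc (2 * p) * j ≡ m + j + p * (2 * (n + j) ∸ 1)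
    exponent-≡ = begin
      m + p * (2 * n ∸ 1) + suc (2 * p) * j       ≡⟨ cong (λ l → m + p * l + suc (2 * p) * j) (2*[1+m]∸1≡1+2*m m) ⟩
      m + p * suc (2 * m) + suc (2 * p) * j       ≡⟨ solve 3 (λ m p j → m :+ p :* (con 1 :+ con 2 :* m) :+ (con 1 :+ con 2 :* p) :* j
                                                           := m :+ j :+ p :* (con 1 :+ con 2 :* (m :+ j))) refl m p j ⟩
      m + j + p * suc (2 * (m + j))               ≡⟨ cong (λ l → m + j + p * l) (2*[1+m]∸1≡1+2*m (m + j)) ⟨
      m + j + p * (2 * (n + j) ∸ 1)               ∎

  termDenominator : ℕ → ℕ
  termDenominator k = (2 * k ∸ 1) ! * 2 ^ (p * (2 * k ∸ 1))

  termDenominator≢0 : ∀ k → NonZero (termDenominator k)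
  termDenominator≢0 k = ℕP.m*n≢0 ((2 * k ∸ 1) !) _ {{(2 * k ∸ 1) ℕP.!≢0}} {{ℕP.m^n≢0 2 (p * (2 * k ∸ 1))}}

  toℚᵘ-term : ∀ k → ℚ.toℚᵘ (term n k) ℚᵘ.≃ frac (X * T k) (termDenominator k) {{termDenominator≢0 k}}
  toℚᵘ-term k = toℚᵘ-frac (X * T k) (termDenominator k) {{termDenominator≢0 k}}

  term-≤-geometricTerm : ∀ j → ℚ.toℚᵘ (term n (n + suc j)) ℚᵘ.≤ geometricTerm j
  term-≤-geometricTerm j = ℚᵘP.≤-trans (ℚᵘP.≤-reflexive (toℚᵘ-term k))
                                       (frac-≤ {{termDenominator≢0 k}} {{D*[1+r]^≢0 (suc j)}} cross)
    where
    open ℕP.≤-Reasoning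
    k = n + suc j
    i = m + suc j
    L = 2 * k ∸ 1
    cross : X * T k * (D * suc r ^ suc j) ℕ.≤ X * termDenominator k
    cross = begin
      X * T k * (D * suc r ^ suc j)    ≡⟨ cong (X * T k *_) (denominator-≡ (suc j)) ⟩
      X * T k * (2 ^ i * 2 ^ (p * L))  ≡⟨ solve 4 (λ x t a b → x :* t :* (a :* b) := x :* ((t :* a) :* b)) refl X (T k) (2 ^ i) (2 ^ (p * L)) ⟩
      X * (T k * 2 ^ i * 2 ^ (p * L))  ≤⟨ ℕP.*-monoʳ-≤ X (ℕP.*-monoˡ-≤ (2 ^ (p * L)) (T[1+i]*2^i≤[2[1+i]∸1]! i)) ⟩
      X * termDenominator k            ∎

  term>0 : ∀ j → 0ℚ < term n (n + suc j)
  term>0 j = ℚP.toℚᵘ-cancel-< (ℚᵘP.<-respʳ-≃ (ℚᵘP.≃-sym (toℚᵘ-term (n + suc j)))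
    (0<frac (termDenominator (n + suc j)) {{termDenominator≢0 (n + suc j)}}
            (ℕP.*-mono-≤ (ℕP.1≤n! (2 * n ∸ 1)) (T[1+i]>0 (m + suc j)))))

  partialR-1>0 : 0ℚ < partialR n 1
  partialR-1>0 = subst (0ℚ <_) (sym (ℚP.+-identityˡ (term n (n + 1)))) (term>0 0)

  c : ℚ
  c = + X ℚ./ (D * r)

  partialR≤c : ∀ N → partialR n N ≤ℚ c
  partialR≤c N = ℚP.toℚᵘ-cancel-≤ (ℚᵘP.≤-trans (partialSums-≤-geometric s ℚᵘP.≃-refl step N)
                                                (ℚᵘP.≤-reflexive (ℚᵘP.≃-sym (toℚᵘ-frac X (D * r)))))
    where
    s : ℕ → ℚᵘ.ℚᵘ
    s N = ℚ.toℚᵘ (partialR n N)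
    step : ∀ N → s (suc N) ℚᵘ.≤ s N ℚᵘ.+ geometricTerm N
    step N = ℚᵘP.≤-trans (ℚᵘP.≤-reflexive (ℚP.toℚᵘ-homo-+ (partialR n N) (term n (n + suc N))))
                         (ℚᵘP.+-monoʳ-≤ (s N) (term-≤-geometricTerm N))

  X*10Q<D*r : X * (10 * Q) ℕ.< 1 * (D * r)
  X*10Q<D*r = begin-strict
    X * (10 * Q)     ≡⟨ solve 2 (λ x y → x :* (con 10 :* y) := con 10 :* x :* y) refl X Q ⟩
    10 * X * Q       <⟨ ℕP.*-monoˡ-< Q (subst (λ l → 10 * l ! ℕ.< 2 ^ m * r) (sym (2*[1+m]∸1≡1+2*m m)) (10*[1+2m]!<2^m*[2^[1+2p]∸1] m 1≤m)) ⟩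
    2 ^ m * r * Q    ≡⟨ solve 3 (λ a b y → a :* b :* y := con 1 :* (a :* y :* b)) refl (2 ^ m) r Q ⟩
    1 * (D * r)      ∎
    where open ℕP.≤-Reasoning

  c<bound : c < bound n
  c<bound = ℚP.toℚᵘ-cancel-< (begin-strict
    ℚ.toℚᵘ c          ≃⟨ toℚᵘ-frac X (D * r) ⟩
    frac X (D * r)    <⟨ frac-< X*10Q<D*r ⟩
    frac 1 (10 * Q)   ≃⟨ toℚᵘ-frac 1 (10 * Q) ⟨
    ℚ.toℚᵘ (bound n)  ∎)
    where open ℚᵘP.≤-Reasoning

lemma4 : (n : ℕ) → 2 ≤ n →
    (∃ λ N → 0ℚ < partialR n N) ×
    (∃ λ c → (c < bound n) × ((N : ℕ) → partialR n N ≤ℚ c))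
lemma4 (suc m) (s≤s 1≤m) = (1 , partialR-1>0) , (c , c<bound , partialR≤c)
  where open RemainderBounds m 1≤m
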